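{- For all integers $m,n\geq 1$, $$N_{m+1}(n)<N_m(n)\quad\text{and}\quad N_1(n)<\{e\,n!\}.$$
   Context: For integers $m,n\ge1$, define $$N_m(n)=n!\left(\sum_{i=1}^{m}\frac{n+2i-1}{(n+2i)!}+\sum_{i=2m+1}^{\infty}\frac{1}{(n+i)!}\right)$$ (equivalently $N_m(n)=n!\left(\sum_{i=1}^{m}\frac{n+2i-1}{(n+2i)!}+\frac{\{e(n+2m)!\}}{(n+2m)!}\right)$). Here $\{x\}=x-\lfloor x\rfloor$ denotes the fractional part of $x$. -}

module Defs where

open import Data.Nat using (ℕ; zero; suc; _+_; _*_; _!; _≤_; _∸_)
open import Data.Nat.Properties using (_!≢0)
open import Data.Integer using (ℤ; +_)
open import Data.Rational using (ℚ; 0ℚ; _/_; floor; Positive)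
  renaming (_+_ to _+ℚ_; _*_ to _*ℚ_; _-_ to _-ℚ_; _≤_ to _≤ℚ_)
open import Data.Product using (Σ; _×_; ∃-syntax)

_/fact_ : ℤ → ℕ → ℚ
a /fact k = (a / (k !)) {{k !≢0}}

sumFrom : ℕ → ℕ → (ℕ → ℚ) → ℚ
sumFrom lo zero    f = 0ℚ
sumFrom lo (suc K) f = sumFrom lo K f +ℚ f (lo + K)

sum1to : ℕ → (ℕ → ℚ) → ℚ
sum1to m f = sumFrom 1 m f

-- Real numbers are represented by (convergent, Cauchy) sequences of
-- rationals; a real is the limit of its sequence of approximants.

RealSeq : Set
RealSeq = ℕ → ℚ

_<ᴿ_ : RealSeq → RealSeq → Set
x <ᴿ y = Σ ℚ λ ε → Positive ε × ∃[ K₀ ] (∀ K → K₀ ≤ K → (x K +ℚ ε) ≤ℚ y K)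

-- N_m(n) = n! ( Σ_{i=1}^m (n+2i-1)/(n+2i)!  +  Σ_{i=2m+1}^∞ 1/(n+i)! ),
-- the K-th approximant truncating the infinite series after K terms
-- (i = 2m+1, …, 2m+K).
Nseq : ℕ → ℕ → RealSeq
Nseq m n K =
  (+ (n !) / 1) *ℚ
    ( sum1to m (λ i → (+ (n + 2 * i ∸ 1)) /fact (n + 2 * i))
      +ℚ sumFrom (suc (2 * m)) K (λ i → (+ 1) /fact (n + i)) )

-- e · n!  via the approximants  n! · Σ_{k=0}^{K-1} 1/k!
eTimesFact : ℕ → RealSeq
eTimesFact n K = (+ (n !) / 1) *ℚ sumFrom 0 K (λ k → (+ 1) /fact k)

fracℚ : ℚ → ℚ
fracℚ p = p -ℚ (floor p / 1)

fracENFact : ℕ → RealSeq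
fracENFact n K = fracℚ (eTimesFact n K)

{-# OPTIONS --safe #-}
module Submission where

-- Since (k-1)/k! = 1/(k-1)! - 1/k!, N_m(n) = n! Σ_{i≥1} ±1/(n+i)! where exactly the
-- terms i = 2, 4, …, 2m carry a minus sign. Flipping the sign of the term i = 2m+2
-- lowers the value by 2 n!/(n+2m+2)!. A tail Σ_{k≥b} 1/k! (b ≥ 1) is below 2/b!, being
-- dominated by a geometric series of ratio 1/2, so half of this gap already separates
-- every approximant of N_{m+1}(n) from the approximants of N_m(n) from the second on.
-- For m = 0 the series n! Σ_{i≥1} 1/(n+i)! is e n! minus the integer n! Σ_{k≤n} 1/k!
-- and lies below 1 when n ≥ 1, so it is {e n!}: the second inequality is the case
-- m = 0 of the first.

open import Defs
open import Data.Product using (Σ; _×_; _,_; proj₁; proj₂)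

module _ where
  open import Data.Nat as ℕ using (ℕ; zero; suc; _!; z≤n; s≤s)
  import Data.Nat.Properties as ℕₚ
  open import Data.Nat.Properties using (_!≢0)
  open import Data.Nat.Divisibility using (m≤n⇒m!∣n!; divides)
  open import Data.Nat.Tactic.RingSolver using (solve-∀)
  open import Data.Integer as ℤ using (+_)
  import Data.Integer.Properties as ℤₚ
  open import Data.Integer.DivMod using ([n/d]*d≤n)
  open import Data.Rational
  open import Data.Rational.Properties
  import Data.Rational.Unnormalised as ℚᵘ
  import Data.Rational.Unnormalised.Properties as ℚᵘₚ
  open import Data.Rational.Solver using (module +-*-Solver)
  open import Data.Sum using (inj₁; inj₂)
  open import Relation.Binary.PropositionalEquality

  fromℕ : ℕ → ℚ
  fromℕ a = + a / 1

  toℚᵘ-/ : ∀ i d → toℚᵘ (i / suc d) ℚᵘ.≃ ℚᵘ.mkℚᵘ i d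
  toℚᵘ-/ i d = toℚᵘ-fromℚᵘ (ℚᵘ.mkℚᵘ i d)

  fromℕ-+ : ∀ a b → fromℕ (a ℕ.+ b) ≡ fromℕ a + fromℕ b
  fromℕ-+ a b = toℚᵘ-injective (begin
    toℚᵘ (fromℕ (a ℕ.+ b))                 ≈⟨ toℚᵘ-/ (+ (a ℕ.+ b)) 0 ⟩
    ℚᵘ.mkℚᵘ (+ (a ℕ.+ b)) 0                ≈⟨ ℚᵘ.*≡* (cong (ℤ._* + 1) numerators) ⟩
    ℚᵘ.mkℚᵘ (+ a) 0 ℚᵘ.+ ℚᵘ.mkℚᵘ (+ b) 0   ≈⟨ ℚᵘₚ.+-cong (toℚᵘ-/ (+ a) 0) (toℚᵘ-/ (+ b) 0) ⟨
    toℚᵘ (fromℕ a) ℚᵘ.+ toℚᵘ (fromℕ b)     ≈⟨ toℚᵘ-homo-+ (fromℕ a) (fromℕ b) ⟨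
    toℚᵘ (fromℕ a + fromℕ b)               ∎)
    where
    open ℚᵘₚ.≃-Reasoning
    numerators : + (a ℕ.+ b) ≡ + a ℤ.* + 1 ℤ.+ + b ℤ.* + 1
    numerators = trans (ℤₚ.pos-+ a b) (sym (cong₂ ℤ._+_ (ℤₚ.*-identityʳ (+ a)) (ℤₚ.*-identityʳ (+ b))))

  fromℕ-* : ∀ a b → fromℕ (a ℕ.* b) ≡ fromℕ a * fromℕ b
  fromℕ-* a b = toℚᵘ-injective (begin
    toℚᵘ (fromℕ (a ℕ.* b))                 ≈⟨ toℚᵘ-/ (+ (a ℕ.* b)) 0 ⟩
    ℚᵘ.mkℚᵘ (+ (a ℕ.* b)) 0                ≈⟨ ℚᵘ.*≡* (cong (ℤ._* + 1) (ℤₚ.pos-* a b)) ⟩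
    ℚᵘ.mkℚᵘ (+ a) 0 ℚᵘ.* ℚᵘ.mkℚᵘ (+ b) 0   ≈⟨ ℚᵘₚ.*-cong (toℚᵘ-/ (+ a) 0) (toℚᵘ-/ (+ b) 0) ⟨
    toℚᵘ (fromℕ a) ℚᵘ.* toℚᵘ (fromℕ b)     ≈⟨ toℚᵘ-homo-* (fromℕ a) (fromℕ b) ⟨
    toℚᵘ (fromℕ a * fromℕ b)               ∎)
    where open ℚᵘₚ.≃-Reasoning

  toℚᵘ-fromℕ*1/ : ∀ a d → toℚᵘ (fromℕ a * (+ 1 / suc d)) ℚᵘ.≃ ℚᵘ.mkℚᵘ (+ a) d
  toℚᵘ-fromℕ*1/ a d = begin
    toℚᵘ (fromℕ a * (+ 1 / suc d))          ≈⟨ toℚᵘ-homo-* (fromℕ a) (+ 1 / suc d) ⟩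
    toℚᵘ (fromℕ a) ℚᵘ.* toℚᵘ (+ 1 / suc d)  ≈⟨ ℚᵘₚ.*-cong (toℚᵘ-/ (+ a) 0) (toℚᵘ-/ (+ 1) d) ⟩
    ℚᵘ.mkℚᵘ (+ a) 0 ℚᵘ.* ℚᵘ.mkℚᵘ (+ 1) d    ≈⟨ ℚᵘ.*≡* cross ⟩
    ℚᵘ.mkℚᵘ (+ a) d                         ∎
    where
    open ℚᵘₚ.≃-Reasoning
    cross : (+ a ℤ.* + 1) ℤ.* + suc d ≡ + a ℤ.* + suc (d ℕ.+ 0)
    cross = cong₂ ℤ._*_ (ℤₚ.*-identityʳ (+ a)) (cong (λ k → + suc k) (sym (ℕₚ.+-identityʳ d)))

  /≡fromℕ*1/ : ∀ a d .{{_ : ℕ.NonZero d}} → + a / d ≡ fromℕ a * (+ 1 / d)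
  /≡fromℕ*1/ a (suc d) = toℚᵘ-injective (ℚᵘₚ.≃-trans (toℚᵘ-/ (+ a) d) (ℚᵘₚ.≃-sym (toℚᵘ-fromℕ*1/ a d)))

  fromℕ*1/≡1 : ∀ d .{{_ : ℕ.NonZero d}} → fromℕ d * (+ 1 / d) ≡ 1ℚ
  fromℕ*1/≡1 (suc d) = toℚᵘ-injective (ℚᵘₚ.≃-trans (toℚᵘ-fromℕ*1/ (suc d) d) (ℚᵘ.*≡* (ℤₚ.*-comm (+ suc d) (+ 1))))

  /1-mono-≤ : ∀ {i j} → i ℤ.≤ j → i / 1 ≤ j / 1
  /1-mono-≤ {i} {j} i≤j = toℚᵘ-cancel-≤
    (ℚᵘₚ.≤-respˡ-≃ (ℚᵘₚ.≃-sym (toℚᵘ-/ i 0)) (ℚᵘₚ.≤-respʳ-≃ (ℚᵘₚ.≃-sym (toℚᵘ-/ j 0))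
      (ℚᵘ.*≤* (ℤₚ.*-monoʳ-≤-nonNeg (+ 1) i≤j))))

  /1-cancel-< : ∀ {i j} → i / 1 < j / 1 → i ℤ.< j
  /1-cancel-< {i} {j} i<j = subst₂ ℤ._<_ (ℤₚ.*-identityʳ i) (ℤₚ.*-identityʳ j)
    (ℚᵘₚ.drop-*<* (ℚᵘₚ.<-respˡ-≃ (toℚᵘ-/ i 0) (ℚᵘₚ.<-respʳ-≃ (toℚᵘ-/ j 0) (toℚᵘ-mono-< i<j))))

  fromℕ-mono-≤ : ∀ {a b} → a ℕ.≤ b → fromℕ a ≤ fromℕ b
  fromℕ-mono-≤ a≤b = /1-mono-≤ (ℤ.+≤+ a≤b)

  p≤p+q : ∀ p {q} → 0ℚ ≤ q → p ≤ p + q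
  p≤p+q p 0≤q = subst (_≤ p + _) (+-identityʳ p) (+-monoʳ-≤ p 0≤q)

  p<p+q : ∀ p {q} → 0ℚ < q → p < p + q
  p<p+q p 0<q = subst (_< p + _) (+-identityʳ p) (+-monoʳ-< p 0<q)

  floor≤ : ∀ p → floor p / 1 ≤ p
  floor≤ p@(mkℚ n d _) = toℚᵘ-cancel-≤ (ℚᵘₚ.≤-respˡ-≃ (ℚᵘₚ.≃-sym (toℚᵘ-/ (floor p) 0))
    (ℚᵘ.*≤* (subst (floor p ℤ.* + suc d ℤ.≤_) (sym (ℤₚ.*-identityʳ n)) ([n/d]*d≤n n (+ suc d)))))

  r≤fracℚ[A+r] : ∀ A r → r < 1ℚ → r ≤ fracℚ (fromℕ A + r)
  r≤fracℚ[A+r] A r r<1 = begin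
    r                    ≡⟨ +-*-Solver.solve 2 (λ a r → r := (a :+ r) :- a) refl (fromℕ A) r ⟩
    p - fromℕ A          ≤⟨ +-monoʳ-≤ p (neg-antimono-≤ (/1-mono-≤ (ℤₚ.i<j⇒i≤pred[j] ⌊p⌋<1+A))) ⟩
    p - floor p / 1      ∎
    where
    open ≤-Reasoning
    open +-*-Solver using (_:=_; _:+_; _:-_)
    p = fromℕ A + r
    ⌊p⌋<1+A : floor p ℤ.< + suc A
    ⌊p⌋<1+A = /1-cancel-< (begin-strict
      floor p / 1     ≤⟨ floor≤ p ⟩
      fromℕ A + r     <⟨ +-monoʳ-< (fromℕ A) r<1 ⟩
      fromℕ A + 1ℚ    ≡⟨ +-comm (fromℕ A) 1ℚ ⟩
      1ℚ + fromℕ A    ≡⟨ fromℕ-+ 1 A ⟨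
      fromℕ (suc A)   ∎)

  sumFrom-+ : ∀ lo A B F → sumFrom lo (A ℕ.+ B) F ≡ sumFrom lo A F + sumFrom (lo ℕ.+ A) B F
  sumFrom-+ lo A zero F = trans (cong (λ K → sumFrom lo K F) (ℕₚ.+-identityʳ A)) (sym (+-identityʳ _))
  sumFrom-+ lo A (suc B) F = begin
    sumFrom lo (A ℕ.+ suc B) F                                      ≡⟨ cong (λ K → sumFrom lo K F) (ℕₚ.+-suc A B) ⟩
    sumFrom lo (A ℕ.+ B) F + F (lo ℕ.+ (A ℕ.+ B))                   ≡⟨ cong₂ _+_ (sumFrom-+ lo A B F) (cong F (sym (ℕₚ.+-assoc lo A B))) ⟩
    (sumFrom lo A F + sumFrom (lo ℕ.+ A) B F) + F (lo ℕ.+ A ℕ.+ B)  ≡⟨ +-assoc (sumFrom lo A F) _ _ ⟩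
    sumFrom lo A F + sumFrom (lo ℕ.+ A) (suc B) F                   ∎
    where open ≡-Reasoning

  sumFrom-shift : ∀ n lo K F → sumFrom lo K (λ i → F (n ℕ.+ i)) ≡ sumFrom (n ℕ.+ lo) K F
  sumFrom-shift n lo zero    F = refl
  sumFrom-shift n lo (suc K) F = cong₂ _+_ (sumFrom-shift n lo K F) (cong F (sym (ℕₚ.+-assoc n lo K)))

  sumFrom-mono : ∀ lo F → (∀ i → 0ℚ ≤ F i) → ∀ {K K′} → K ℕ.≤ K′ → sumFrom lo K F ≤ sumFrom lo K′ F
  sumFrom-mono lo F F≥0 {K′ = zero}   z≤n = ≤-refl
  sumFrom-mono lo F F≥0 {K′ = suc K′} K≤1+K′ with ℕₚ.m≤n⇒m<n∨m≡n K≤1+K′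
  ... | inj₁ (s≤s K≤K′) = ≤-trans (sumFrom-mono lo F F≥0 K≤K′) (p≤p+q _ (F≥0 (lo ℕ.+ K′)))
  ... | inj₂ refl       = ≤-refl

  1/fact : ℕ → ℚ
  1/fact k = (+ 1) /fact k

  1/fact>0 : ∀ k → 0ℚ < 1/fact k
  1/fact>0 k = positive⁻¹ (1/fact k) {{normalize-pos 1 (k !) {{k !≢0}}}}

  1/fact≥0 : ∀ k → 0ℚ ≤ 1/fact k
  1/fact≥0 k = <⇒≤ (1/fact>0 k)

  k!*1/k!≡1 : ∀ k → fromℕ (k !) * 1/fact k ≡ 1ℚ
  k!*1/k!≡1 k = fromℕ*1/≡1 (k !) {{k !≢0}}

  a/k!≡a*1/k! : ∀ a k → (+ a) /fact k ≡ fromℕ a * 1/fact k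
  a/k!≡a*1/k! a k = /≡fromℕ*1/ a (k !) {{k !≢0}}

  1/k!≡[1+k]*1/[1+k]! : ∀ k → 1/fact k ≡ fromℕ (suc k) * 1/fact (suc k)
  1/k!≡[1+k]*1/[1+k]! k = begin
    x                                       ≡⟨ *-identityʳ x ⟨
    x * 1ℚ                                  ≡⟨ cong (x *_) (k!*1/k!≡1 (suc k)) ⟨
    x * (fromℕ (suc k ℕ.* k !) * y)         ≡⟨ cong (λ c → x * (c * y)) (fromℕ-* (suc k) (k !)) ⟩
    x * ((fromℕ (suc k) * fromℕ (k !)) * y) ≡⟨ +-*-Solver.solve 4 (λ x u v y → x :* ((v :* u) :* y) := (u :* x) :* (v :* y)) refl x (fromℕ (k !)) (fromℕ (suc k)) y ⟩
    (fromℕ (k !) * x) * (fromℕ (suc k) * y) ≡⟨ cong (_* (fromℕ (suc k) * y)) (k!*1/k!≡1 k) ⟩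
    1ℚ * (fromℕ (suc k) * y)                ≡⟨ *-identityˡ _ ⟩
    fromℕ (suc k) * y                       ∎
    where
    open ≡-Reasoning
    open +-*-Solver using (_:=_; _:*_)
    x = 1/fact k
    y = 1/fact (suc k)

  k/[1+k]!+1/[1+k]!≡1/k! : ∀ k → (+ k) /fact (suc k) + 1/fact (suc k) ≡ 1/fact k
  k/[1+k]!+1/[1+k]!≡1/k! k = begin
    (+ k) /fact (suc k) + y        ≡⟨ cong (_+ y) (a/k!≡a*1/k! k (suc k)) ⟩
    fromℕ k * y + y                ≡⟨ +-comm _ y ⟩
    y + fromℕ k * y                ≡⟨ cong (_+ fromℕ k * y) (*-identityˡ y) ⟨
    1ℚ * y + fromℕ k * y           ≡⟨ *-distribʳ-+ y 1ℚ (fromℕ k) ⟨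
    (1ℚ + fromℕ k) * y             ≡⟨ cong (_* y) (fromℕ-+ 1 k) ⟨
    fromℕ (suc k) * y              ≡⟨ 1/k!≡[1+k]*1/[1+k]! k ⟨
    1/fact k                       ∎
    where
    open ≡-Reasoning
    y = 1/fact (suc k)

  double-1/[1+k]!≤1/k! : ∀ k → 1 ℕ.≤ k → 1/fact (suc k) + 1/fact (suc k) ≤ 1/fact k
  double-1/[1+k]!≤1/k! k 1≤k = begin
    y + y                  ≡⟨ cong₂ _+_ (*-identityˡ y) (*-identityˡ y) ⟨
    1ℚ * y + 1ℚ * y        ≡⟨ *-distribʳ-+ y 1ℚ 1ℚ ⟨
    fromℕ 2 * y            ≤⟨ *-monoʳ-≤-nonNeg y {{nonNegative (1/fact≥0 (suc k))}} (fromℕ-mono-≤ (s≤s 1≤k)) ⟩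
    fromℕ (suc k) * y      ≡⟨ 1/k!≡[1+k]*1/[1+k]! k ⟨
    1/fact k               ∎
    where
    open ≤-Reasoning
    y = 1/fact (suc k)

  -- 2/(b+K)! is the allowance left after K terms; each new term uses at most half of it.
  sumFrom-1/fact+allowance≤ : ∀ b K → 1 ℕ.≤ b →
    sumFrom b K 1/fact + (1/fact (b ℕ.+ K) + 1/fact (b ℕ.+ K)) ≤ 1/fact b + 1/fact b
  sumFrom-1/fact+allowance≤ b zero 1≤b = ≤-reflexive
    (trans (+-identityˡ _) (cong (λ k → 1/fact k + 1/fact k) (ℕₚ.+-identityʳ b)))
  sumFrom-1/fact+allowance≤ b (suc K) 1≤b = begin
    (S + y) + (z + z)        ≡⟨ cong (λ k → (S + y) + (1/fact k + 1/fact k)) (ℕₚ.+-suc b K) ⟩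
    (S + y) + (y′ + y′)      ≤⟨ +-monoʳ-≤ (S + y) (double-1/[1+k]!≤1/k! (b ℕ.+ K) (ℕₚ.≤-trans 1≤b (ℕₚ.m≤m+n b K))) ⟩
    (S + y) + y              ≡⟨ +-assoc S y y ⟩
    S + (y + y)              ≤⟨ sumFrom-1/fact+allowance≤ b K 1≤b ⟩
    1/fact b + 1/fact b      ∎
    where
    open ≤-Reasoning
    S = sumFrom b K 1/fact
    y = 1/fact (b ℕ.+ K)
    z = 1/fact (b ℕ.+ suc K)
    y′ = 1/fact (suc (b ℕ.+ K))

  sumFrom-1/fact<double : ∀ b K → 1 ℕ.≤ b → sumFrom b K 1/fact < 1/fact b + 1/fact b
  sumFrom-1/fact<double b K 1≤b = <-≤-trans
    (p<p+q _ (+-mono-< (1/fact>0 (b ℕ.+ K)) (1/fact>0 (b ℕ.+ K))))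
    (sumFrom-1/fact+allowance≤ b K 1≤b)

  n!*sumFrom0-integral : ∀ n N → N ℕ.≤ suc n → Σ ℕ λ A → fromℕ (n !) * sumFrom 0 N 1/fact ≡ fromℕ A
  n!*sumFrom0-integral n zero    _ = 0 , *-zeroʳ (fromℕ (n !))
  n!*sumFrom0-integral n (suc N) (s≤s N≤n)
    with n!*sumFrom0-integral n N (ℕₚ.m≤n⇒m≤1+n N≤n) | m≤n⇒m!∣n! N≤n
  ... | A , c*S≡A | divides q n!≡q*N! = A ℕ.+ q , (begin
    c * (sumFrom 0 N 1/fact + 1/fact N)              ≡⟨ *-distribˡ-+ c _ _ ⟩
    c * sumFrom 0 N 1/fact + c * 1/fact N            ≡⟨ cong₂ _+_ c*S≡A (cong (λ k → fromℕ k * 1/fact N) n!≡q*N!) ⟩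
    fromℕ A + fromℕ (q ℕ.* N !) * 1/fact N           ≡⟨ cong (λ x → fromℕ A + x * 1/fact N) (fromℕ-* q (N !)) ⟩
    fromℕ A + (fromℕ q * fromℕ (N !)) * 1/fact N     ≡⟨ cong (_+_ (fromℕ A)) (*-assoc (fromℕ q) _ _) ⟩
    fromℕ A + fromℕ q * (fromℕ (N !) * 1/fact N)     ≡⟨ cong (λ x → fromℕ A + fromℕ q * x) (k!*1/k!≡1 N) ⟩
    fromℕ A + fromℕ q * 1ℚ                           ≡⟨ cong (_+_ (fromℕ A)) (*-identityʳ (fromℕ q)) ⟩
    fromℕ A + fromℕ q                                ≡⟨ fromℕ-+ A q ⟨
    fromℕ (A ℕ.+ q)                                  ∎)
    where
    open ≡-Reasoning
    c = fromℕ (n !)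

  fact-pos : ∀ n → Positive (fromℕ (n !))
  fact-pos n = normalize-pos (n !) 1 {{_}} {{n !≢0}}

  fact-nonNeg : ∀ n → NonNegative (fromℕ (n !))
  fact-nonNeg n = pos⇒nonNeg (fromℕ (n !)) {{fact-pos n}}

  pairTerm : ℕ → ℕ → ℚ
  pairTerm n i = (+ (n ℕ.+ 2 ℕ.* i ℕ.∸ 1)) /fact (n ℕ.+ 2 ℕ.* i)

  -- Half of the exact difference N_m(n) - N_{m+1}(n) = 2 n!/(n+2m+2)!.
  halfGap : ℕ → ℕ → ℚ
  halfGap m n = fromℕ (n !) * 1/fact (suc (n ℕ.+ suc (2 ℕ.* m)))

  halfGap-pos : ∀ m n → Positive (halfGap m n)
  halfGap-pos m n = pos*pos⇒pos (fromℕ (n !)) {{fact-pos n}} (1/fact k) {{positive (1/fact>0 k)}}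
    where k = suc (n ℕ.+ suc (2 ℕ.* m))

  Nseq-mono : ∀ m n {K K′} → K ℕ.≤ K′ → Nseq m n K ≤ Nseq m n K′
  Nseq-mono m n K≤K′ = *-monoˡ-≤-nonNeg (fromℕ (n !)) {{fact-nonNeg n}}
    (+-monoʳ-≤ (sum1to m (pairTerm n)) (sumFrom-mono (suc (2 ℕ.* m)) (λ i → 1/fact (n ℕ.+ i)) (λ i → 1/fact≥0 (n ℕ.+ i)) K≤K′))

  Nseq-two : ∀ m n → let P = n ℕ.+ suc (2 ℕ.* m) in
    Nseq m n 2 ≡ fromℕ (n !) * (sum1to m (pairTerm n) + (1/fact P + 1/fact (suc P)))
  Nseq-two m n = cong (λ T → fromℕ (n !) * (sum1to m (pairTerm n) + T)) (cong₂ _+_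
    (trans (+-identityˡ _) (cong (λ i → 1/fact (n ℕ.+ i)) (ℕₚ.+-identityʳ _)))
    (cong 1/fact (index m n)))
    where
    index : ∀ m n → n ℕ.+ (suc (2 ℕ.* m) ℕ.+ 1) ≡ suc (n ℕ.+ suc (2 ℕ.* m))
    index = solve-∀

  Nseq-suc+halfGap≤Nseq-two : ∀ m n K → Nseq (suc m) n K + halfGap m n ≤ Nseq m n 2
  Nseq-suc+halfGap≤Nseq-two m n K = begin
    c * ((S + g) + T) + c * x   ≡⟨ *-distribˡ-+ c _ x ⟨
    c * (((S + g) + T) + x)     ≤⟨ *-monoˡ-≤-nonNeg c {{fact-nonNeg n}} (+-monoˡ-≤ x (+-monoʳ-≤ (S + g) T≤x)) ⟩
    c * (((S + g) + x) + x)     ≡⟨ cong (λ y → c * (y + x)) (+-assoc S g x) ⟩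
    c * ((S + (g + x)) + x)     ≡⟨ cong (c *_) (+-assoc S (g + x) x) ⟩
    c * (S + ((g + x) + x))     ≡⟨ cong (λ y → c * (S + (y + x))) g+x≡1/P! ⟩
    c * (S + (1/fact P + x))    ≡⟨ Nseq-two m n ⟨
    Nseq m n 2                  ∎
    where
    open ≤-Reasoning
    c = fromℕ (n !)
    S = sum1to m (pairTerm n)
    P = n ℕ.+ suc (2 ℕ.* m)
    x = 1/fact (suc P)
    g = pairTerm n (suc m)
    T = sumFrom (suc (2 ℕ.* suc m)) K (λ i → 1/fact (n ℕ.+ i))
    index₁ : ∀ m n → n ℕ.+ 2 ℕ.* suc m ≡ suc (n ℕ.+ suc (2 ℕ.* m))
    index₁ = solve-∀
    index₂ : ∀ m n → n ℕ.+ suc (2 ℕ.* suc m) ≡ suc (suc (n ℕ.+ suc (2 ℕ.* m)))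
    index₂ = solve-∀
    g+x≡1/P! : g + x ≡ 1/fact P
    g+x≡1/P! = trans (cong (λ k → (+ (k ℕ.∸ 1)) /fact k + x) (index₁ m n)) (k/[1+k]!+1/[1+k]!≡1/k! P)
    T≤x : T ≤ x
    T≤x = begin
      T                                           ≡⟨ sumFrom-shift n _ K 1/fact ⟩
      sumFrom (n ℕ.+ suc (2 ℕ.* suc m)) K 1/fact  ≡⟨ cong (λ b → sumFrom b K 1/fact) (index₂ m n) ⟩
      sumFrom (suc (suc P)) K 1/fact              <⟨ sumFrom-1/fact<double (suc (suc P)) K (s≤s z≤n) ⟩
      1/fact (suc (suc P)) + 1/fact (suc (suc P)) ≤⟨ double-1/[1+k]!≤1/k! (suc P) (s≤s z≤n) ⟩
      x                                           ∎

  Nseq-zero≤fracENFact : ∀ n K → 1 ℕ.≤ n → Nseq 0 n K ≤ fracENFact n (suc n ℕ.+ K)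
  Nseq-zero≤fracENFact n K 1≤n = begin
    Nseq 0 n K                        ≡⟨ cong (c *_) (trans (+-identityˡ _) tail≡) ⟩
    r                                 ≤⟨ r≤fracℚ[A+r] A r r<1 ⟩
    fracℚ (fromℕ A + r)               ≡⟨ cong fracℚ e[n!]≡A+r ⟨
    fracENFact n (suc n ℕ.+ K)        ∎
    where
    open ≤-Reasoning
    c = fromℕ (n !)
    r = c * sumFrom (suc n) K 1/fact
    integralPart = n!*sumFrom0-integral n (suc n) ℕₚ.≤-refl
    A = proj₁ integralPart
    tail≡ : sumFrom 1 K (λ i → 1/fact (n ℕ.+ i)) ≡ sumFrom (suc n) K 1/fact
    tail≡ = trans (sumFrom-shift n 1 K 1/fact) (cong (λ b → sumFrom b K 1/fact) (ℕₚ.+-comm n 1))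
    e[n!]≡A+r : c * sumFrom 0 (suc n ℕ.+ K) 1/fact ≡ fromℕ A + r
    e[n!]≡A+r = trans (cong (c *_) (sumFrom-+ 0 (suc n) K 1/fact))
      (trans (*-distribˡ-+ c _ _) (cong (_+ r) (proj₂ integralPart)))
    r<1 : r < 1ℚ
    r<1 = begin-strict
      r                                     <⟨ *-monoʳ-<-pos c {{fact-pos n}} (sumFrom-1/fact<double (suc n) K (s≤s z≤n)) ⟩
      c * (1/fact (suc n) + 1/fact (suc n)) ≤⟨ *-monoˡ-≤-nonNeg c {{fact-nonNeg n}} (double-1/[1+k]!≤1/k! n 1≤n) ⟩
      c * 1/fact n                          ≡⟨ k!*1/k!≡1 n ⟩
      1ℚ                                    ∎

  Nseq-suc<ᴿNseq : ∀ m n → Nseq (suc m) n <ᴿ Nseq m n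
  Nseq-suc<ᴿNseq m n = halfGap m n , halfGap-pos m n , 2 , λ K 2≤K →
    ≤-trans (Nseq-suc+halfGap≤Nseq-two m n K) (Nseq-mono m n 2≤K)

  Nseq-one<ᴿfracENFact : ∀ n → 1 ℕ.≤ n → Nseq 1 n <ᴿ fracENFact n
  Nseq-one<ᴿfracENFact n 1≤n = halfGap 0 n , halfGap-pos 0 n , suc n ℕ.+ 2 , bound
    where
    bound : ∀ K → suc n ℕ.+ 2 ℕ.≤ K → Nseq 1 n K + halfGap 0 n ≤ fracENFact n K
    bound K le with ℕₚ.m≤n⇒∃[o]m+o≡n (ℕₚ.≤-trans (ℕₚ.m≤m+n (suc n) 2) le)
    ... | o , refl = begin
      Nseq 1 n (suc n ℕ.+ o) + halfGap 0 n   ≤⟨ Nseq-suc+halfGap≤Nseq-two 0 n (suc n ℕ.+ o) ⟩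
      Nseq 0 n 2                           ≤⟨ Nseq-mono 0 n (ℕₚ.+-cancelˡ-≤ (suc n) 2 o le) ⟩
      Nseq 0 n o                           ≤⟨ Nseq-zero≤fracENFact n o 1≤n ⟩
      fracENFact n (suc n ℕ.+ o)           ∎
      where open ≤-Reasoning

open import Data.Nat using (ℕ; _+_; _≥_)
open import Data.Nat.Properties using (+-comm)
open import Relation.Binary.PropositionalEquality using (subst)

corollary4 : ∀ (m n : ℕ) → m ≥ 1 → n ≥ 1 →
    (Nseq (m + 1) n <ᴿ Nseq m n) × (Nseq 1 n <ᴿ fracENFact n)
corollary4 m n _ n≥1 =
  subst (λ k → Nseq k n <ᴿ Nseq m n) (+-comm 1 m) (Nseq-suc<ᴿNseq m n) , Nseq-one<ᴿfracENFact n n≥1
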